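{- Let $p$ be a prime and $n\geq 2$ an integer. Then $$\frac14\leq\frac{p^2-1}{3p^2}\leq C_p(n)\leq\frac{p-1}{2p}<\frac12.$$
   Context: $C_p(n)=A_p(n)/p^n$, where $A_p(n)$ is the number of monic polynomials of degree $n$ in $\mathbb{F}_p[x]$ having no roots in $\mathbb{F}_p$. -}

module Defs where

open import Data.Nat using (ℕ; zero; suc; _+_; _*_; _∸_; _^_; NonZero)
open import Data.Nat.Properties using (m^n≢0; m*n≢0)
open import Data.Nat.Divisibility using (_∣_; _∣?_)
open import Data.Nat.Primality using (Prime; prime⇒nonZero)
open import Data.Fin using (Fin; toℕ)
open import Data.Fin.Properties using (any?)
open import Data.Vec using (Vec; []; _∷_)
open import Data.List using (List; [_]; map; concatMap; allFin; filter; length)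
open import Data.Product using (∃)
open import Data.Integer using (+_)
open import Data.Rational using (ℚ; _/_)
open import Relation.Nullary using (¬_; Dec; ¬?)

-- A monic polynomial of degree n over F_p, x^n + a_{n-1} x^{n-1} + ... + a_0,
-- is represented by its coefficient vector (a_0, ..., a_{n-1}) with a_i ∈ F_p = Fin p.

evalCoeffs : ∀ {p k} → Vec (Fin p) k → ℕ → ℕ
evalCoeffs [] x = 0
evalCoeffs (a ∷ as) x = toℕ a + x * evalCoeffs as x

evalMonic : ∀ {p n} → Vec (Fin p) n → ℕ → ℕ
evalMonic {n = n} as x = x ^ n + evalCoeffs as x

HasRoot : ∀ {p n} → Vec (Fin p) n → Set
HasRoot {p} as = ∃ λ (c : Fin p) → p ∣ evalMonic as (toℕ c)

hasRoot? : ∀ {p n} (as : Vec (Fin p) n) → Dec (HasRoot as)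
hasRoot? {p} as = any? (λ c → p ∣? evalMonic as (toℕ c))

allMonic : (p n : ℕ) → List (Vec (Fin p) n)
allMonic p zero = [ [] ]
allMonic p (suc n) = concatMap (λ v → map (_∷ v) (allFin p)) (allMonic p n)

A : (p n : ℕ) → ℕ
A p n = length (filter (λ as → ¬? (hasRoot? as)) (allMonic p n))

C : (p n : ℕ) → Prime p → ℚ
C p n pp = (+ A p n) / (p ^ n)
  where instance
    _ = prime⇒nonZero pp
    _ = m^n≢0 p n

lowerBound : (p : ℕ) → Prime p → ℚ
lowerBound p pp = (+ (p ^ 2 ∸ 1)) / (3 * p ^ 2)
  where instance
    _ = prime⇒nonZero pp
    _ = m^n≢0 p 2
    _ = m*n≢0 3 (p ^ 2)

upperBound : (p : ℕ) → Prime p → ℚ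
upperBound p pp = (+ (p ∸ 1)) / (2 * p)
  where instance
    _ = prime⇒nonZero pp
    _ = m*n≢0 2 p

{-# OPTIONS --safe #-}
module Submission where

-- Write N_S(n) for the number of monic polynomials of degree n over F_p without
-- roots in a set S of points. For c ∉ S the polynomials of degree n + 1 vanishing
-- at c are (x − c)·g with g of degree n, and (x − c)·g has the same roots as g
-- outside c; hence N_S(n+1) = N_{c∷S}(n+1) + N_S(n). Together with N_∅(n) = p^n
-- and N_S(0) = 1, induction on S gives the Bonferroni inequalities
--   N_S(n) ≤ p^n − k p^(n−1) + C(k,2) p^(n−2),
--   N_S(n) ≥ p^n − k p^(n−1) + C(k,2) p^(n−2) − C(k,3) p^(n−3)
-- for |S| = k. For S = F_p we have k = p and N_S(n) = A_p(n), and the right-hand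
-- sides divided by p^n simplify to (p − 1)/(2p) and (p² − 1)/(3p²).

open import Data.Nat
  using (ℕ; zero; suc; _+_; _*_; _∸_; _^_; _≥_; s≤s; z≤n; NonZero; NonTrivial; nonTrivial⇒n>1)
open import Data.Nat.Primality using (Prime)
open import Data.List using (List; []; _∷_; length)
open import Data.List.Relation.Unary.All using (All)
open import Relation.Binary.PropositionalEquality using (_≡_; _≢_)

module Fraction where
  open import Data.Nat as ℕ using ()
  open import Data.Integer as ℤ using (+_; +≤+; +<+)
  open import Data.Integer.Properties using (pos-*)
  open import Data.Rational using (_≤_; _<_; _/_)
  open import Data.Rational.Properties using (toℚᵘ-cancel-≤; toℚᵘ-cancel-<; toℚᵘ-fromℚᵘ)
  import Data.Rational.Unnormalised as ℚᵘ
  import Data.Rational.Unnormalised.Properties as ℚᵘ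
  open import Relation.Binary.PropositionalEquality using (subst₂)

  fraction-≤ : ∀ a b c d .{{_ : NonZero b}} .{{_ : NonZero d}} →
               a * d ℕ.≤ c * b → (+ a) / b ≤ (+ c) / d
  fraction-≤ a (suc b) c (suc d) ad≤cb = toℚᵘ-cancel-≤
    (ℚᵘ.≤-respˡ-≃ (ℚᵘ.≃-sym (toℚᵘ-fromℚᵘ (ℚᵘ.mkℚᵘ (+ a) b)))
    (ℚᵘ.≤-respʳ-≃ (ℚᵘ.≃-sym (toℚᵘ-fromℚᵘ (ℚᵘ.mkℚᵘ (+ c) d)))
      (ℚᵘ.*≤* (subst₂ ℤ._≤_ (pos-* a (suc d)) (pos-* c (suc b)) (+≤+ ad≤cb)))))

  fraction-< : ∀ a b c d .{{_ : NonZero b}} .{{_ : NonZero d}} →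
               a * d ℕ.< c * b → (+ a) / b < (+ c) / d
  fraction-< a (suc b) c (suc d) ad<cb = toℚᵘ-cancel-<
    (ℚᵘ.<-respˡ-≃ (ℚᵘ.≃-sym (toℚᵘ-fromℚᵘ (ℚᵘ.mkℚᵘ (+ a) b)))
    (ℚᵘ.<-respʳ-≃ (ℚᵘ.≃-sym (toℚᵘ-fromℚᵘ (ℚᵘ.mkℚᵘ (+ c) d)))
      (ℚᵘ.*<* (subst₂ ℤ._<_ (pos-* a (suc d)) (pos-* c (suc b)) (+<+ ad<cb)))))

module Binomial where
  open import Data.Nat.Properties using (*-distribˡ-∸; *-identityʳ; m+n∸n≡m)
  open import Data.Nat.Combinatorics using (_C_; nC1≡n; nCk+nC[k+1]≡[n+1]C[k+1])
  open import Data.Nat.Tactic.RingSolver using (solve-∀)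
  open import Relation.Binary.PropositionalEquality using (refl; cong; cong₂; module ≡-Reasoning)
  open ≡-Reasoning

  [1+n]C2≡n+nC2 : ∀ n → suc n C 2 ≡ n + n C 2
  [1+n]C2≡n+nC2 n = begin
    suc n C 2       ≡⟨ nCk+nC[k+1]≡[n+1]C[k+1] n 1 ⟨
    n C 1 + n C 2   ≡⟨ cong (_+ n C 2) (nC1≡n n) ⟩
    n + n C 2       ∎

  2*nC2+n≡n*n : ∀ n → 2 * (n C 2) + n ≡ n * n
  2*nC2+n≡n*n zero    = refl
  2*nC2+n≡n*n (suc n) = begin
    2 * (suc n C 2) + suc n         ≡⟨ cong (λ c → 2 * c + suc n) ([1+n]C2≡n+nC2 n) ⟩
    2 * (n + n C 2) + suc n         ≡⟨ regroup n (n C 2) ⟩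
    (2 * (n C 2) + n) + (2 * n + 1) ≡⟨ cong (_+ (2 * n + 1)) (2*nC2+n≡n*n n) ⟩
    n * n + (2 * n + 1)             ≡⟨ square n ⟩
    suc n * suc n                   ∎
    where
    regroup : ∀ n c → 2 * (n + c) + suc n ≡ (2 * c + n) + (2 * n + 1)
    regroup = solve-∀
    square : ∀ n → n * n + (2 * n + 1) ≡ suc n * suc n
    square = solve-∀

  2*nC2≡n*[n∸1] : ∀ n → 2 * (n C 2) ≡ n * (n ∸ 1)
  2*nC2≡n*[n∸1] n = begin
    2 * (n C 2)           ≡⟨ m+n∸n≡m (2 * (n C 2)) n ⟨
    2 * (n C 2) + n ∸ n   ≡⟨ cong (_∸ n) (2*nC2+n≡n*n n) ⟩
    n * n ∸ n             ≡⟨ cong (n * n ∸_) (*-identityʳ n) ⟨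
    n * n ∸ n * 1         ≡⟨ *-distribˡ-∸ n n 1 ⟨
    n * (n ∸ 1)           ∎

  6*nC3+3*n*n≡n*n*n+2*n : ∀ n → 6 * (n C 3) + 3 * (n * n) ≡ n * n * n + 2 * n
  6*nC3+3*n*n≡n*n*n+2*n zero    = refl
  6*nC3+3*n*n≡n*n*n+2*n (suc n) = begin
    6 * (suc n C 3) + 3 * (suc n * suc n)
      ≡⟨ cong (λ c → 6 * c + 3 * (suc n * suc n)) (nCk+nC[k+1]≡[n+1]C[k+1] n 2) ⟨
    6 * (n C 2 + n C 3) + 3 * (suc n * suc n)
      ≡⟨ regroup n (n C 2) (n C 3) ⟩
    3 * (2 * (n C 2) + n) + (6 * (n C 3) + 3 * (n * n)) + 3 * (n + 1)
      ≡⟨ cong₂ (λ a b → 3 * a + b + 3 * (n + 1)) (2*nC2+n≡n*n n) (6*nC3+3*n*n≡n*n*n+2*n n) ⟩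
    3 * (n * n) + (n * n * n + 2 * n) + 3 * (n + 1)
      ≡⟨ cube n ⟩
    suc n * suc n * suc n + 2 * suc n ∎
    where
    regroup : ∀ n a b → 6 * (a + b) + 3 * (suc n * suc n) ≡
                        3 * (2 * a + n) + (6 * b + 3 * (n * n)) + 3 * (n + 1)
    regroup = solve-∀
    cube : ∀ n → 3 * (n * n) + (n * n * n + 2 * n) + 3 * (n + 1) ≡ suc n * suc n * suc n + 2 * suc n
    cube = solve-∀

module Estimates where
  open import Data.Nat using (_≤_; _<_)
  open import Data.Nat.Properties
  open import Data.Nat.Combinatorics using (_C_)
  open import Data.Nat.Tactic.RingSolver using (solve-∀)
  open import Relation.Binary.PropositionalEquality using (cong)
  open Binomial using (2*nC2+n≡n*n; 2*nC2≡n*[n∸1]; 6*nC3+3*n*n≡n*n*n+2*n)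
  open ≤-Reasoning

  quarter-bound : ∀ p → 1 < p → 1 * (3 * p ^ 2) ≤ (p ^ 2 ∸ 1) * 4
  quarter-bound 1             (s≤s ())
  quarter-bound (suc (suc r)) _ = begin
    1 * (3 * p ^ 2)                   ≤⟨ m≤m+n _ (r * r + 4 * r) ⟩
    1 * (3 * p ^ 2) + (r * r + 4 * r) ≡⟨ expand r ⟩
    (r * r + 4 * r + 3) * 4           ≡⟨ cong (λ t → (t ∸ 1) * 4) (square r) ⟨
    (p ^ 2 ∸ 1) * 4                   ∎
    where
    p : ℕ
    p = suc (suc r)
    expand : ∀ r → 1 * (3 * (suc (suc r) * (suc (suc r) * 1))) + (r * r + 4 * r) ≡ (r * r + 4 * r + 3) * 4
    expand = solve-∀
    square : ∀ r → suc (suc r) * (suc (suc r) * 1) ≡ suc (r * r + 4 * r + 3)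
    square = solve-∀

  half-bound : ∀ p → 1 < p → (p ∸ 1) * 2 < 1 * (2 * p)
  half-bound (suc r) _ = begin-strict
    r * 2           <⟨ n<1+n (r * 2) ⟩
    suc (r * 2)     ≤⟨ m≤m+n _ 1 ⟩
    suc (r * 2) + 1 ≡⟨ double r ⟩
    1 * (2 * suc r) ∎
    where
    double : ∀ r → suc (r * 2) + 1 ≡ 1 * (2 * suc r)
    double = solve-∀

  upper-bound : ∀ p n N → p * N + p * p ^ suc n ≤ p ^ suc (suc n) + (p C 2) * p ^ n →
                N * (2 * p) ≤ (p ∸ 1) * p ^ suc n
  upper-bound p n N bound = begin
    N * (2 * p)              ≡⟨ *-comm N (2 * p) ⟩
    2 * p * N                ≡⟨ *-assoc 2 p N ⟩
    2 * (p * N)              ≤⟨ *-monoʳ-≤ 2 pN≤ ⟩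
    2 * ((p C 2) * p ^ n)    ≡⟨ *-assoc 2 (p C 2) (p ^ n) ⟨
    2 * (p C 2) * p ^ n      ≡⟨ cong (_* p ^ n) (2*nC2≡n*[n∸1] p) ⟩
    p * (p ∸ 1) * p ^ n      ≡⟨ regroup p (p ∸ 1) (p ^ n) ⟩
    (p ∸ 1) * p ^ suc n      ∎
    where
    pN≤ : p * N ≤ (p C 2) * p ^ n
    pN≤ = +-cancelʳ-≤ (p * p ^ suc n) _ _ (≤-trans bound (≤-reflexive (+-comm (p ^ suc (suc n)) _)))
    regroup : ∀ p a q → p * a * q ≡ a * (p * q)
    regroup = solve-∀

  quartic-bound : ∀ p q N → (p C 2) * (p * q) ≤ p * N + (p C 3) * q →
                  p ^ 2 * (p * (p * q)) ≤ p * (p * q) + N * (3 * p ^ 2)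
  quartic-bound p q N bound = *-cancelˡ-≤ 2 (+-cancelˡ-≤ X _ _ (begin
    X + 2 * X                                       ≡⟨ expand₁ p q ⟩
    3 * (p * p) * (p * p) * q                       ≡⟨ cong (λ t → 3 * t * (p * p) * q) (2*nC2+n≡n*n p) ⟨
    3 * (2 * a + p) * (p * p) * q                   ≡⟨ expand₂ p q a ⟩
    6 * p * (a * (p * q)) + 3 * (p * p * p) * q     ≤⟨ +-monoˡ-≤ _ (*-monoʳ-≤ (6 * p) bound) ⟩
    6 * p * (p * N + b * q) + 3 * (p * p * p) * q   ≡⟨ expand₃ p q N b ⟩
    6 * p * p * N + (6 * b + 3 * (p * p)) * (p * q)
      ≡⟨ cong (λ t → 6 * p * p * N + t * (p * q)) (6*nC3+3*n*n≡n*n*n+2*n p) ⟩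
    6 * p * p * N + (p * p * p + 2 * p) * (p * q)   ≡⟨ expand₄ p q N ⟩
    X + 2 * (p * (p * q) + N * (3 * p ^ 2))         ∎))
    where
    X a b : ℕ
    X = p ^ 2 * (p * (p * q))
    a = p C 2
    b = p C 3
    expand₁ : ∀ p q → p * (p * 1) * (p * (p * q)) + 2 * (p * (p * 1) * (p * (p * q))) ≡
                      3 * (p * p) * (p * p) * q
    expand₁ = solve-∀
    expand₂ : ∀ p q a → 3 * (2 * a + p) * (p * p) * q ≡ 6 * p * (a * (p * q)) + 3 * (p * p * p) * q
    expand₂ = solve-∀
    expand₃ : ∀ p q N b → 6 * p * (p * N + b * q) + 3 * (p * p * p) * q ≡
                          6 * p * p * N + (6 * b + 3 * (p * p)) * (p * q)
    expand₃ = solve-∀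
    expand₄ : ∀ p q N → 6 * p * p * N + (p * p * p + 2 * p) * (p * q) ≡
                        p * (p * 1) * (p * (p * q)) + 2 * (p * (p * q) + N * (3 * (p * (p * 1))))
    expand₄ = solve-∀

  lower-bound : ∀ p n N →
    p ^ (3 + n) + (p C 2) * p ^ suc n ≤ p * N + p * p ^ (2 + n) + (p C 3) * p ^ n →
    (p ^ 2 ∸ 1) * p ^ (2 + n) ≤ N * (3 * p ^ 2)
  lower-bound p n N bound = begin
    (p ^ 2 ∸ 1) * p ^ (2 + n)            ≡⟨ *-distribʳ-∸ (p ^ (2 + n)) (p ^ 2) 1 ⟩
    p ^ 2 * p ^ (2 + n) ∸ 1 * p ^ (2 + n) ≡⟨ cong (p ^ 2 * p ^ (2 + n) ∸_) (*-identityˡ (p ^ (2 + n))) ⟩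
    p ^ 2 * p ^ (2 + n) ∸ p ^ (2 + n)     ≤⟨ m≤n+o⇒m∸n≤o _ (p ^ (2 + n)) (quartic-bound p (p ^ n) N reduced) ⟩
    N * (3 * p ^ 2)                       ∎
    where
    reduced : (p C 2) * p ^ suc n ≤ p * N + (p C 3) * p ^ n
    reduced = +-cancelˡ-≤ (p ^ (3 + n)) _ _
      (≤-trans bound (≤-reflexive (regroup (p * N) (p ^ (3 + n)) ((p C 3) * p ^ n))))
      where
      regroup : ∀ x y z → x + y + z ≡ y + (x + z)
      regroup = solve-∀

module Bonferroni {X : Set} (p : ℕ) (N : List X → ℕ → ℕ)
  (N-[] : ∀ n → N [] n ≡ p ^ n)
  (N-zero : ∀ S → N S 0 ≡ 1)
  (N-∷ : ∀ {c S} → All (c ≢_) S → ∀ n → N (c ∷ S) (suc n) + N S n ≡ N S (suc n))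
  where

  open import Data.Nat using (_≤_)
  open import Data.Nat.Properties
  open import Data.Nat.Combinatorics using (_C_; nCk+nC[k+1]≡[n+1]C[k+1])
  open import Data.Nat.Tactic.RingSolver using (solve-∀)
  open import Data.List.Relation.Unary.AllPairs using ([]; _∷_)
  open import Data.List.Relation.Unary.Unique.Propositional using (Unique)
  open import Relation.Binary.PropositionalEquality using (cong)
  open Binomial using ([1+n]C2≡n+nC2)
  open ≤-Reasoning

  -- bonferroniᵢ is the i-th Bonferroni inequality for N S m multiplied by p, which
  -- clears the negative powers of p and makes it hold for every m.

  N≤p^n : ∀ {S} → Unique S → ∀ n → N S n ≤ p ^ n
  N≤p^n {[]}    _            n       = ≤-reflexive (N-[] n)
  N≤p^n {c ∷ S} _            zero    = ≤-reflexive (N-zero (c ∷ S))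
  N≤p^n {c ∷ S} (c∉S ∷ S!) (suc n) = begin
    N (c ∷ S) (suc n)            ≤⟨ m≤m+n _ (N S n) ⟩
    N (c ∷ S) (suc n) + N S n    ≡⟨ N-∷ c∉S n ⟩
    N S (suc n)                  ≤⟨ N≤p^n S! (suc n) ⟩
    p ^ suc n                    ∎

  bonferroni₁ : ∀ {S} → Unique S → ∀ n → p ^ suc n ≤ p * N S n + length S * p ^ n
  bonferroni₁ {[]}    _          n       = ≤-reflexive (begin-equality
    p * p ^ n              ≡⟨ cong (p *_) (N-[] n) ⟨
    p * N [] n             ≡⟨ +-identityʳ _ ⟨
    p * N [] n + 0         ∎)
  bonferroni₁ {c ∷ S} _          zero    = begin
    p * 1                          ≡⟨ cong (p *_) (N-zero (c ∷ S)) ⟨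
    p * N (c ∷ S) 0                ≤⟨ m≤m+n _ _ ⟩
    p * N (c ∷ S) 0 + length (c ∷ S) * 1 ∎
  bonferroni₁ {c ∷ S} (c∉S ∷ S!) (suc n) = begin
    p ^ suc (suc n)                   ≤⟨ bonferroni₁ S! (suc n) ⟩
    p * N S (suc n) + k * p ^ suc n   ≡⟨ cong (λ t → p * t + k * p ^ suc n) (N-∷ c∉S n) ⟨
    p * (N′ + N S n) + k * p ^ suc n  ≤⟨ +-monoˡ-≤ _ (*-monoʳ-≤ p (+-monoʳ-≤ N′ (N≤p^n S! n))) ⟩
    p * (N′ + p ^ n) + k * p ^ suc n  ≡⟨ regroup p N′ (p ^ n) k ⟩
    p * N′ + suc k * p ^ suc n        ∎
    where
    k N′ : ℕ
    k = length S
    N′ = N (c ∷ S) (suc n)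
    regroup : ∀ p a q k → p * (a + q) + k * (p * q) ≡ p * a + suc k * (p * q)
    regroup = solve-∀

  bonferroni₂ : ∀ {S} → Unique S → ∀ n →
    p * N S (suc n) + length S * p ^ suc n ≤ p ^ suc (suc n) + (length S C 2) * p ^ n
  bonferroni₂ {[]}    _          n = ≤-reflexive (begin-equality
    p * N [] (suc n) + 0   ≡⟨ +-identityʳ _ ⟩
    p * N [] (suc n)       ≡⟨ cong (p *_) (N-[] (suc n)) ⟩
    p ^ suc (suc n)        ≡⟨ +-identityʳ _ ⟨
    p ^ suc (suc n) + 0    ∎)
  bonferroni₂ {c ∷ S} (c∉S ∷ S!) n = begin
    p * N′ + suc k * p ^ suc n
      ≡⟨ regroup₁ p N′ k (p ^ n) ⟩
    p * N′ + k * p ^ suc n + p * p ^ n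
      ≤⟨ +-monoʳ-≤ _ (bonferroni₁ S! n) ⟩
    p * N′ + k * p ^ suc n + (p * N S n + k * p ^ n)
      ≡⟨ regroup₂ p N′ (N S n) k (p ^ n) ⟩
    p * (N′ + N S n) + k * p ^ suc n + k * p ^ n
      ≡⟨ cong (λ t → p * t + k * p ^ suc n + k * p ^ n) (N-∷ c∉S n) ⟩
    p * N S (suc n) + k * p ^ suc n + k * p ^ n
      ≤⟨ +-monoˡ-≤ _ (bonferroni₂ S! n) ⟩
    p ^ suc (suc n) + (k C 2) * p ^ n + k * p ^ n
      ≡⟨ regroup₃ (p ^ suc (suc n)) (k C 2) k (p ^ n) ⟩
    p ^ suc (suc n) + (k + k C 2) * p ^ n
      ≡⟨ cong (λ t → p ^ suc (suc n) + t * p ^ n) ([1+n]C2≡n+nC2 k) ⟨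
    p ^ suc (suc n) + (suc k C 2) * p ^ n
      ∎
    where
    k N′ : ℕ
    k = length S
    N′ = N (c ∷ S) (suc n)
    regroup₁ : ∀ p a k q → p * a + suc k * (p * q) ≡ p * a + k * (p * q) + p * q
    regroup₁ = solve-∀
    regroup₂ : ∀ p a b k q → p * a + k * (p * q) + (p * b + k * q) ≡ p * (a + b) + k * (p * q) + k * q
    regroup₂ = solve-∀
    regroup₃ : ∀ P c k q → P + c * q + k * q ≡ P + (k + c) * q
    regroup₃ = solve-∀

  bonferroni₃ : ∀ {S} → Unique S → ∀ n →
    p ^ (3 + n) + (length S C 2) * p ^ suc n ≤
    p * N S (2 + n) + length S * p ^ (2 + n) + (length S C 3) * p ^ n
  bonferroni₃ {[]}    _          n = ≤-reflexive (begin-equality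
    p ^ (3 + n) + 0          ≡⟨ cong (λ t → p * t + 0) (N-[] (2 + n)) ⟨
    p * N [] (2 + n) + 0     ≡⟨ +-identityʳ _ ⟨
    p * N [] (2 + n) + 0 + 0 ∎)
  bonferroni₃ {c ∷ S} (c∉S ∷ S!) n = begin
    p ^ (3 + n) + (suc k C 2) * p ^ suc n
      ≡⟨ cong (λ t → p ^ (3 + n) + t * p ^ suc n) ([1+n]C2≡n+nC2 k) ⟩
    p ^ (3 + n) + (k + k C 2) * p ^ suc n
      ≡⟨ regroup₁ (p ^ (3 + n)) k (k C 2) (p ^ suc n) ⟩
    p ^ (3 + n) + (k C 2) * p ^ suc n + k * p ^ suc n
      ≤⟨ +-monoˡ-≤ _ (bonferroni₃ S! n) ⟩
    p * N S (2 + n) + k * p ^ (2 + n) + (k C 3) * p ^ n + k * p ^ suc n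
      ≡⟨ cong (λ t → p * t + k * p ^ (2 + n) + (k C 3) * p ^ n + k * p ^ suc n) (N-∷ c∉S (suc n)) ⟨
    p * (N′ + N S (suc n)) + k * p ^ (2 + n) + (k C 3) * p ^ n + k * p ^ suc n
      ≡⟨ regroup₂ p N′ (N S (suc n)) k (p ^ (2 + n)) ((k C 3) * p ^ n) (p ^ suc n) ⟩
    p * N′ + k * p ^ (2 + n) + (k C 3) * p ^ n + (p * N S (suc n) + k * p ^ suc n)
      ≤⟨ +-monoʳ-≤ (p * N′ + k * p ^ (2 + n) + (k C 3) * p ^ n) (bonferroni₂ S! n) ⟩
    p * N′ + k * p ^ (2 + n) + (k C 3) * p ^ n + (p ^ (2 + n) + (k C 2) * p ^ n)
      ≡⟨ regroup₃ p N′ k (p ^ (2 + n)) (k C 2) (k C 3) (p ^ n) ⟩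
    p * N′ + suc k * p ^ (2 + n) + (k C 2 + k C 3) * p ^ n
      ≡⟨ cong (λ t → p * N′ + suc k * p ^ (2 + n) + t * p ^ n) (nCk+nC[k+1]≡[n+1]C[k+1] k 2) ⟩
    p * N′ + suc k * p ^ (2 + n) + (suc k C 3) * p ^ n ∎
    where
    k N′ : ℕ
    k = length S
    N′ = N (c ∷ S) (2 + n)
    regroup₁ : ∀ P k c q → P + (k + c) * q ≡ P + c * q + k * q
    regroup₁ = solve-∀
    regroup₂ : ∀ p a b k Q R q → p * (a + b) + k * Q + R + k * q ≡ p * a + k * Q + R + (p * b + k * q)
    regroup₂ = solve-∀
    regroup₃ : ∀ p a k Q c₂ c₃ q →
               p * a + k * Q + c₃ * q + (Q + c₂ * q) ≡ p * a + suc k * Q + (c₂ + c₃) * q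
    regroup₃ = solve-∀

module FiniteSums where
  open import Data.Nat.Properties using (+-*-semiring; +-comm)
  import Data.Nat.ListAction as List
  import Data.Nat.ListAction.Properties as List
  open import Data.Fin using (Fin; zero; suc)
  open import Data.Fin.Properties using (punchInᵢ≢i)
  open import Data.Vec.Functional using (Vector; removeAt)
  open import Data.List using (List; []; _∷_; _++_; map; concatMap; tabulate; filter; length)
  open import Data.List.Properties using (map-++)
  open import Data.Bool using (if_then_else_; true; false)
  open import Relation.Nullary using (does)
  open import Relation.Unary using (Pred; Decidable)
  open import Level using (0ℓ)
  open import Relation.Binary.PropositionalEquality
  open import Algebra.Properties.Semiring.Sum +-*-semiring using (sum; sum-syntax; sum-cong-≗; sum-remove)
  open ≡-Reasoning

  ∑-const : ∀ n k → ∑[ i < n ] k ≡ n * k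
  ∑-const zero    k = refl
  ∑-const (suc n) k = cong (k +_) (∑-const n k)

  ∑-pull-out : ∀ {n} (g h : Vector ℕ n) i →
               (∀ j → j ≢ i → g j ≡ h j) → h i ≡ 0 → sum g ≡ sum h + g i
  ∑-pull-out {suc n} g h i g≡h hᵢ≡0 = begin
    sum g                          ≡⟨ sum-remove g ⟩
    g i + sum (removeAt g i)       ≡⟨ cong (g i +_) (sum-cong-≗ (λ j → g≡h _ (punchInᵢ≢i i j))) ⟩
    g i + sum (removeAt h i)       ≡⟨ cong (λ t → g i + (t + sum (removeAt h i))) hᵢ≡0 ⟨
    g i + (h i + sum (removeAt h i)) ≡⟨ cong (g i +_) (sum-remove h) ⟨
    g i + sum h                    ≡⟨ +-comm (g i) (sum h) ⟩
    sum h + g i                    ∎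

  length-filter≡sum : ∀ {A : Set} {P : Pred A 0ℓ} (P? : Decidable P) xs →
    length (filter P? xs) ≡ List.sum (map (λ x → if does (P? x) then 1 else 0) xs)
  length-filter≡sum P? []       = refl
  length-filter≡sum P? (x ∷ xs) with does (P? x)
  ... | true  = cong suc (length-filter≡sum P? xs)
  ... | false = length-filter≡sum P? xs

  sum-map-concatMap : ∀ {A B : Set} (f : B → ℕ) (g : A → List B) xs →
    List.sum (map f (concatMap g xs)) ≡ List.sum (map (λ x → List.sum (map f (g x))) xs)
  sum-map-concatMap f g []       = refl
  sum-map-concatMap f g (x ∷ xs) = begin
    List.sum (map f (g x ++ concatMap g xs))                   ≡⟨ cong List.sum (map-++ f (g x) _) ⟩
    List.sum (map f (g x) ++ map f (concatMap g xs))           ≡⟨ List.sum-++ (map f (g x)) _ ⟩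
    List.sum (map f (g x)) + List.sum (map f (concatMap g xs)) ≡⟨ cong (_ +_) (sum-map-concatMap f g xs) ⟩
    List.sum (map f (g x)) + List.sum (map (λ x → List.sum (map f (g x))) xs) ∎

  sum-map-tabulate : ∀ {A : Set} {n} (f : A → ℕ) (g : Fin n → A) →
                     List.sum (map f (tabulate g)) ≡ ∑[ i < n ] f (g i)
  sum-map-tabulate {n = zero}  f g = refl
  sum-map-tabulate {n = suc n} f g = cong (f (g zero) +_) (sum-map-tabulate f (λ i → g (suc i)))

module Congruence (p : ℕ) (pp : Prime p) where
  open import Level using (0ℓ)
  open import Data.Nat using (_%_; _/_; _<_; >-nonZero; >-nonZero⁻¹)
  open import Data.Nat.Properties
  open import Data.Nat.DivMod
    using (_mod_; m%n<n; %-distribˡ-+; %-distribˡ-*; m%n%n≡m%n; m≡m%n+[m/n]*n; m*n%n≡0; m<n⇒m%n≡m)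
  open import Data.Nat.Divisibility using (_∣_; divides; m%n≡0⇒n∣m; n∣m⇒m%n≡0)
  open import Data.Nat.Primality using (prime⇒nonZero)
  open import Data.Nat.Coprimality using (Coprime; coprime-divisor; prime⇒coprime)
  open import Data.Fin using (Fin; toℕ)
  open import Data.Fin.Properties using (toℕ-fromℕ<; toℕ-injective; toℕ<n)
  open import Data.Fin.Permutation using (Permutation; permutation)
  open import Relation.Nullary using (contradiction)
  open import Relation.Binary using (Setoid; IsEquivalence; tri<; tri≈; tri>)
  open import Relation.Binary.PropositionalEquality
  import Relation.Binary.Reasoning.Setoid
  open import Algebra.Properties.Semiring.Sum +-*-semiring using (sum-syntax; ∑-permute)

  instance
    p≢0 : NonZero p
    p≢0 = prime⇒nonZero pp

  -- Congruence modulo p. It is a record so that x and y can be inferred from a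
  -- proof, which they could not be from the bare equation x % p ≡ y % p.
  infix 4 _≈_
  record _≈_ (x y : ℕ) : Set where
    constructor mod-≡
    field %-≡ : x % p ≡ y % p
  open _≈_

  ≈-isEquivalence : IsEquivalence _≈_
  ≈-isEquivalence = record
    { refl  = mod-≡ refl
    ; sym   = λ x≈y → mod-≡ (sym (%-≡ x≈y))
    ; trans = λ x≈y y≈z → mod-≡ (trans (%-≡ x≈y) (%-≡ y≈z))
    }

  ≈-setoid : Setoid 0ℓ 0ℓ
  ≈-setoid = record { isEquivalence = ≈-isEquivalence }

  open IsEquivalence ≈-isEquivalence public
    using () renaming (refl to ≈-refl; sym to ≈-sym; trans to ≈-trans)
  module ≈-Reasoning = Relation.Binary.Reasoning.Setoid ≈-setoid

  ≡⇒≈ : ∀ {x y} → x ≡ y → x ≈ y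
  ≡⇒≈ refl = ≈-refl

  +-cong : ∀ {x y u v} → x ≈ y → u ≈ v → x + u ≈ y + v
  +-cong {x} {y} {u} {v} (mod-≡ x≡y) (mod-≡ u≡v) = mod-≡ (begin
    (x + u) % p             ≡⟨ %-distribˡ-+ x u p ⟩
    (x % p + u % p) % p     ≡⟨ cong₂ (λ s t → (s + t) % p) x≡y u≡v ⟩
    (y % p + v % p) % p     ≡⟨ %-distribˡ-+ y v p ⟨
    (y + v) % p             ∎)
    where open ≡-Reasoning

  *-cong : ∀ {x y u v} → x ≈ y → u ≈ v → x * u ≈ y * v
  *-cong {x} {y} {u} {v} (mod-≡ x≡y) (mod-≡ u≡v) = mod-≡ (begin
    (x * u) % p             ≡⟨ %-distribˡ-* x u p ⟩
    (x % p * (u % p)) % p   ≡⟨ cong₂ (λ s t → (s * t) % p) x≡y u≡v ⟩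
    (y % p * (v % p)) % p   ≡⟨ %-distribˡ-* y v p ⟨
    (y * v) % p             ∎)
    where open ≡-Reasoning

  +-congˡ : ∀ x {u v} → u ≈ v → x + u ≈ x + v
  +-congˡ x = +-cong (≈-refl {x})

  +-congʳ : ∀ x {u v} → u ≈ v → u + x ≈ v + x
  +-congʳ x u≈v = +-cong u≈v (≈-refl {x})

  *-congˡ : ∀ x {u v} → u ≈ v → x * u ≈ x * v
  *-congˡ x = *-cong (≈-refl {x})

  ∣⇒≈0 : ∀ {x} → p ∣ x → x ≈ 0
  ∣⇒≈0 {x} p∣x = mod-≡ (trans (n∣m⇒m%n≡0 x p p∣x) (sym (m*n%n≡0 0 p)))

  *-≈0 : ∀ x {y} → p ∣ y → x * y ≈ 0
  *-≈0 x p∣y = ≈-trans (*-congˡ x (∣⇒≈0 p∣y)) (≡⇒≈ (*-zeroʳ x))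

  ≈0⇒∣ : ∀ {x} → x ≈ 0 → p ∣ x
  ≈0⇒∣ {x} (mod-≡ x≡0) = m%n≡0⇒n∣m x p (trans x≡0 (m*n%n≡0 0 p))

  ≈⇒∣∸ : ∀ {x y} → x ≈ y → p ∣ x ∸ y
  ≈⇒∣∸ {x} {y} (mod-≡ x≡y) = divides (x / p ∸ y / p) (begin
    x ∸ y                                      ≡⟨ cong₂ _∸_ (m≡m%n+[m/n]*n x p) (m≡m%n+[m/n]*n y p) ⟩
    (x % p + x / p * p) ∸ (y % p + y / p * p)  ≡⟨ cong (λ r → (r + x / p * p) ∸ (y % p + y / p * p)) x≡y ⟩
    (y % p + x / p * p) ∸ (y % p + y / p * p)  ≡⟨ [m+n]∸[m+o]≡n∸o (y % p) _ _ ⟩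
    x / p * p ∸ y / p * p                      ≡⟨ *-distribʳ-∸ p (x / p) (y / p) ⟨
    (x / p ∸ y / p) * p                        ∎)
    where open ≡-Reasoning

  toℕ-mod : ∀ x → toℕ (x mod p) ≈ x
  toℕ-mod x = mod-≡ (trans (cong (_% p) (toℕ-fromℕ< (m%n<n x p))) (m%n%n≡m%n x p))

  toℕ-≈-injective : ∀ {a b : Fin p} → toℕ a ≈ toℕ b → a ≡ b
  toℕ-≈-injective {a} {b} (mod-≡ a≡b) =
    toℕ-injective (trans (sym (m<n⇒m%n≡m (toℕ<n a))) (trans a≡b (m<n⇒m%n≡m (toℕ<n b))))

  -- (p − 1)·K is a representative of −K that needs no truncated subtraction
  neg : ℕ → ℕ
  neg K = (p ∸ 1) * K

  +-neg : ∀ K → K + neg K ≈ 0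
  +-neg K = mod-≡ (begin
    (K + (p ∸ 1) * K) % p   ≡⟨⟩
    ((1 + (p ∸ 1)) * K) % p ≡⟨ cong (λ t → (t * K) % p) (m+[n∸m]≡n (>-nonZero⁻¹ p)) ⟩
    (p * K) % p             ≡⟨ cong (_% p) (*-comm p K) ⟩
    (K * p) % p             ≡⟨ m*n%n≡0 K p ⟩
    0                       ≡⟨ m*n%n≡0 0 p ⟨
    0 % p                   ∎)
    where open ≡-Reasoning

  *-cancel-<-≈ : ∀ {m n} y → m < n → n < p → m * y ≈ n * y → p ∣ y
  *-cancel-<-≈ {m} {n} y m<n n<p my≈ny = coprime-divisor p⊥n∸m p∣[n∸m]y
    where
    p⊥n∸m : Coprime p (n ∸ m)
    p⊥n∸m = prime⇒coprime pp {{>-nonZero (m<n⇒0<n∸m m<n)}} (≤-<-trans (m∸n≤m n m) n<p)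
    p∣[n∸m]y : p ∣ (n ∸ m) * y
    p∣[n∸m]y = subst (p ∣_) (sym (*-distribʳ-∸ y n m)) (≈⇒∣∸ (≈-sym my≈ny))

  *-cancel-≈ : ∀ {c d : Fin p} y → c ≢ d → toℕ c * y ≈ toℕ d * y → p ∣ y
  *-cancel-≈ {c} {d} y c≢d cy≈dy with <-cmp (toℕ c) (toℕ d)
  ... | tri< c<d _ _ = *-cancel-<-≈ y c<d (toℕ<n d) cy≈dy
  ... | tri≈ _ c≡d _ = contradiction (toℕ-injective c≡d) c≢d
  ... | tri> _ _ d<c = *-cancel-<-≈ y d<c (toℕ<n c) (≈-sym cy≈dy)

  shift : ℕ → Fin p → Fin p
  shift K b = (toℕ b + K) mod p

  shift-cancel : ∀ {K L} → K + L ≈ 0 → ∀ b → shift L (shift K b) ≡ b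
  shift-cancel {K} {L} K+L≈0 b = toℕ-≈-injective (begin
    toℕ (shift L (shift K b))        ≈⟨ toℕ-mod (toℕ (shift K b) + L) ⟩
    toℕ (shift K b) + L              ≈⟨ +-congʳ L (toℕ-mod (toℕ b + K)) ⟩
    toℕ b + K + L                    ≡⟨ +-assoc (toℕ b) K L ⟩
    toℕ b + (K + L)                  ≈⟨ +-congˡ (toℕ b) K+L≈0 ⟩
    toℕ b + 0                        ≡⟨ +-identityʳ (toℕ b) ⟩
    toℕ b                            ∎)
    where open ≈-Reasoning

  translation : ℕ → Permutation p p
  translation K = permutation (shift K) (shift (neg K))
    (shift-cancel (≈-trans (≡⇒≈ (+-comm (neg K) K)) (+-neg K)))
    (shift-cancel (+-neg K))

  ∑-shift : ∀ K (G : Fin p → ℕ) → ∑[ b < p ] G (shift K b) ≡ ∑[ b < p ] G b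
  ∑-shift K G = sym (∑-permute G (translation K))

module RootCounting (p : ℕ) (pp : Prime p) where
  open import Defs using (evalCoeffs; evalMonic; hasRoot?; allMonic; A)
  open import Data.Nat using (_≤_; _<_)
  open import Data.Nat.Properties
  open import Data.Nat.Combinatorics using (_C_)
  open import Data.Nat.DivMod using (_mod_)
  open import Data.Nat.Divisibility using (_∣_; _∣?_; ∣1⇒≡1)
  open import Data.Nat.Primality using (prime⇒nonTrivial)
  import Data.Nat.ListAction as List
  open import Data.Fin using (Fin; toℕ)
  open import Data.Vec using (Vec; []; _∷_)
  open import Data.List using (map; allFin)
  open import Data.List.Properties using (map-∘; length-tabulate)
  open import Data.List.Relation.Unary.All using ([]; _∷_)
  open import Data.List.Relation.Unary.Any using (here; there)
  open import Data.List.Membership.Propositional using (_∈_)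
  open import Data.List.Membership.Propositional.Properties using (∈-allFin)
  open import Data.List.Relation.Unary.Unique.Propositional.Properties using (allFin⁺)
  open import Data.Product using (_,_)
  open import Data.Bool using (if_then_else_)
  open import Function using (_⇔_; mk⇔; Equivalence)
  open import Relation.Nullary using (¬_; yes; no; does; ¬?; contradiction)
  open import Relation.Binary.PropositionalEquality
  open import Data.Nat.Tactic.RingSolver using (solve-∀)
  open import Algebra.Properties.Semiring.Sum +-*-semiring using (sum-syntax; sum-cong-≗; ∑-distrib-+)
  open FiniteSums
  open Congruence p pp

  Poly : ℕ → Set
  Poly n = Vec (Fin p) n

  sumMonic : ∀ n → (Poly n → ℕ) → ℕ
  sumMonic zero    f = f []
  sumMonic (suc n) f = sumMonic n (λ v → ∑[ a < p ] f (a ∷ v))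

  sumMonic-cong : ∀ n {f g : Poly n → ℕ} → (∀ v → f v ≡ g v) → sumMonic n f ≡ sumMonic n g
  sumMonic-cong zero    f≡g = f≡g []
  sumMonic-cong (suc n) f≡g = sumMonic-cong n (λ v → sum-cong-≗ (λ a → f≡g (a ∷ v)))

  sumMonic-distrib-+ : ∀ n (f g : Poly n → ℕ) →
                       sumMonic n (λ v → f v + g v) ≡ sumMonic n f + sumMonic n g
  sumMonic-distrib-+ zero    f g = refl
  sumMonic-distrib-+ (suc n) f g = trans
    (sumMonic-cong n (λ v → ∑-distrib-+ (λ a → f (a ∷ v)) (λ a → g (a ∷ v))))
    (sumMonic-distrib-+ n _ _)

  sumMonic-const : ∀ n k → sumMonic n (λ _ → k) ≡ p ^ n * k
  sumMonic-const zero    k = sym (*-identityˡ k)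
  sumMonic-const (suc n) k = begin
    sumMonic n (λ _ → ∑[ a < p ] k) ≡⟨ sumMonic-cong n (λ _ → ∑-const p k) ⟩
    sumMonic n (λ _ → p * k)        ≡⟨ sumMonic-const n (p * k) ⟩
    p ^ n * (p * k)                 ≡⟨ *-assoc (p ^ n) p k ⟨
    p ^ n * p * k                   ≡⟨ cong (_* k) (*-comm (p ^ n) p) ⟩
    p ^ suc n * k                   ∎
    where open ≡-Reasoning

  sum-map-allMonic : ∀ n (f : Poly n → ℕ) → List.sum (map f (allMonic p n)) ≡ sumMonic n f
  sum-map-allMonic zero    f = +-identityʳ (f [])
  sum-map-allMonic (suc n) f = begin
    List.sum (map f (allMonic p (suc n)))
      ≡⟨ sum-map-concatMap f (λ v → map (_∷ v) (allFin p)) (allMonic p n) ⟩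
    List.sum (map (λ v → List.sum (map f (map (_∷ v) (allFin p)))) (allMonic p n))
      ≡⟨ sum-map-allMonic n _ ⟩
    sumMonic n (λ v → List.sum (map f (map (_∷ v) (allFin p))))
      ≡⟨ sumMonic-cong n (λ v → trans (cong List.sum (sym (map-∘ (allFin p))))
                                       (sum-map-tabulate (λ a → f (a ∷ v)) (λ a → a))) ⟩
    sumMonic (suc n) f ∎
    where open ≡-Reasoning

  evalMonic-∷ : ∀ {n} a (v : Poly n) x → evalMonic (a ∷ v) x ≡ toℕ a + x * evalMonic v x
  evalMonic-∷ {n} a v x = regroup x (x ^ n) (toℕ a) (evalCoeffs v x)
    where
    regroup : ∀ x y a e → x * y + (a + x * e) ≡ a + x * (y + e)
    regroup = solve-∀

  -- Synthetic division by x − c: the coefficients of the quotient of a ∷ v are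
  -- the values at c of v, tail v, tail (tail v), ...
  quotient : ∀ {n} → Fin p → Poly n → Poly n
  quotient c []      = []
  quotient c (b ∷ w) = shift (toℕ c * evalMonic w (toℕ c)) b ∷ quotient c w

  -- f(x) − f(c) = (x − c)·q(x) for f = a ∷ v and q = quotient c v, with the
  -- subtractions moved across.
  remainder-theorem : ∀ {n} c a (v : Poly n) x →
    evalMonic (a ∷ v) x + toℕ c * evalMonic (quotient c v) x ≈
    evalMonic (a ∷ v) (toℕ c) + x * evalMonic (quotient c v) x
  remainder-theorem c a []      x = ≡⇒≈ (linear x (toℕ a) (toℕ c))
    where
    linear : ∀ x a c → x * 1 + (a + x * 0) + c * 1 ≡ c * 1 + (a + c * 0) + x * 1
    linear = solve-∀
  remainder-theorem c a (b ∷ w) x = begin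
    evalMonic (a ∷ b ∷ w) x + c′ * evalMonic (quotient c (b ∷ w)) x
      ≡⟨ cong₂ (λ s t → s + c′ * t) (evalMonic-∷ a (b ∷ w) x) (evalMonic-∷ r (quotient c w) x) ⟩
    toℕ a + x * V x + c′ * (toℕ r + x * Q x)
      ≡⟨ regroup (toℕ a) x (V x) c′ (toℕ r) (Q x) ⟩
    toℕ a + c′ * toℕ r + x * (V x + c′ * Q x)
      ≈⟨ +-cong (+-congˡ (toℕ a) (*-congˡ c′ r≈Vc)) (*-congˡ x (remainder-theorem c b w x)) ⟩
    toℕ a + c′ * V c′ + x * (V c′ + x * Q x)
      ≈⟨ +-congˡ (toℕ a + c′ * V c′) (*-congˡ x (+-congʳ (x * Q x) (≈-sym r≈Vc))) ⟩
    toℕ a + c′ * V c′ + x * (toℕ r + x * Q x)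
      ≡⟨ cong₂ (λ s t → s + x * t) (evalMonic-∷ a (b ∷ w) c′) (evalMonic-∷ r (quotient c w) x) ⟨
    evalMonic (a ∷ b ∷ w) c′ + x * evalMonic (quotient c (b ∷ w)) x ∎
    where
    open ≈-Reasoning
    c′ : ℕ
    c′ = toℕ c
    V Q : ℕ → ℕ
    V = evalMonic (b ∷ w)
    Q = evalMonic (quotient c w)
    r : Fin p
    r = shift (c′ * evalMonic w c′) b
    r≈Vc : toℕ r ≈ V c′
    r≈Vc = ≈-trans (toℕ-mod (toℕ b + c′ * evalMonic w c′)) (≡⇒≈ (sym (evalMonic-∷ b w c′)))
    regroup : ∀ a x v c r q → a + x * v + c * (r + x * q) ≡ a + c * r + x * (v + c * q)
    regroup = solve-∀

  quotient-∣⇔ : ∀ {n} {c d} a (v : Poly n) → p ∣ evalMonic (a ∷ v) (toℕ c) → c ≢ d →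
    p ∣ evalMonic (a ∷ v) (toℕ d) ⇔ p ∣ evalMonic (quotient c v) (toℕ d)
  quotient-∣⇔ {c = c} {d} a v p∣f[c] c≢d = mk⇔
    (λ p∣f[d] → *-cancel-≈ (Q d′) c≢d (begin
      c′ * Q d′           ≡⟨⟩
      0 + c′ * Q d′       ≈⟨ +-congʳ (c′ * Q d′) (≈-sym (∣⇒≈0 p∣f[d])) ⟩
      f d′ + c′ * Q d′    ≈⟨ f[d]+cQ[d]≈dQ[d] ⟩
      d′ * Q d′           ∎))
    (λ p∣Q[d] → ≈0⇒∣ (begin
      f d′                ≡⟨ +-identityʳ (f d′) ⟨
      f d′ + 0            ≈⟨ +-congˡ (f d′) (≈-sym (*-≈0 c′ p∣Q[d])) ⟩
      f d′ + c′ * Q d′    ≈⟨ f[d]+cQ[d]≈dQ[d] ⟩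
      d′ * Q d′           ≈⟨ *-≈0 d′ p∣Q[d] ⟩
      0                   ∎))
    where
    open ≈-Reasoning
    c′ d′ : ℕ
    c′ = toℕ c
    d′ = toℕ d
    f Q : ℕ → ℕ
    f = evalMonic (a ∷ v)
    Q = evalMonic (quotient c v)
    f[d]+cQ[d]≈dQ[d] : f d′ + c′ * Q d′ ≈ d′ * Q d′
    f[d]+cQ[d]≈dQ[d] = ≈-trans (remainder-theorem c a v d′) (+-congʳ (d′ * Q d′) (∣⇒≈0 p∣f[c]))

  [p∤_] : ℕ → ℕ
  [p∤ x ] = if does (p ∣? x) then 0 else 1

  [p∤]-∣ : ∀ {x} → p ∣ x → [p∤ x ] ≡ 0
  [p∤]-∣ {x} p∣x with p ∣? x
  ... | yes _  = refl
  ... | no p∤x = contradiction p∣x p∤x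

  [p∤]-∤ : ∀ {x} → ¬ p ∣ x → [p∤ x ] ≡ 1
  [p∤]-∤ {x} p∤x with p ∣? x
  ... | yes p∣x = contradiction p∣x p∤x
  ... | no _    = refl

  [p∤]-cong : ∀ {x y} → p ∣ x ⇔ p ∣ y → [p∤ x ] ≡ [p∤ y ]
  [p∤]-cong {x} {y} x⇔y with p ∣? x
  ... | yes p∣x = sym ([p∤]-∣ (Equivalence.to x⇔y p∣x))
  ... | no p∤x  = sym ([p∤]-∤ (λ p∣y → p∤x (Equivalence.from x⇔y p∣y)))

  noRootIn : ∀ {n} → List (Fin p) → Poly n → ℕ
  noRootIn []      f = 1
  noRootIn (d ∷ S) f = [p∤ evalMonic f (toℕ d) ] * noRootIn S f

  noRootIn-∈ : ∀ {n d} S (f : Poly n) → d ∈ S → p ∣ evalMonic f (toℕ d) → noRootIn S f ≡ 0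
  noRootIn-∈ (d ∷ S) f (here refl) p∣f[d] = cong (_* noRootIn S f) ([p∤]-∣ p∣f[d])
  noRootIn-∈ (e ∷ S) f (there d∈S) p∣f[d] =
    trans (cong ([p∤ evalMonic f (toℕ e) ] *_) (noRootIn-∈ S f d∈S p∣f[d]))
          (*-zeroʳ [p∤ evalMonic f (toℕ e) ])

  noRootIn-rootless : ∀ {n} S (f : Poly n) →
                      (∀ (d : Fin p) → ¬ p ∣ evalMonic f (toℕ d)) → noRootIn S f ≡ 1
  noRootIn-rootless []      f rootless = refl
  noRootIn-rootless (d ∷ S) f rootless = cong₂ _*_ ([p∤]-∤ (rootless d)) (noRootIn-rootless S f rootless)

  noRootIn-quotient : ∀ {n} {c S} a (v : Poly n) → p ∣ evalMonic (a ∷ v) (toℕ c) → All (c ≢_) S →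
    noRootIn S (a ∷ v) ≡ noRootIn S (quotient c v)
  noRootIn-quotient a v p∣f[c] []          = refl
  noRootIn-quotient a v p∣f[c] (c≢d ∷ c∉S) =
    cong₂ _*_ ([p∤]-cong (quotient-∣⇔ a v p∣f[c] c≢d)) (noRootIn-quotient a v p∣f[c] c∉S)

  vanishingConstant : ∀ {n} → Fin p → Poly n → Fin p
  vanishingConstant c v = neg (toℕ c * evalMonic v (toℕ c)) mod p

  vanishingConstant-root : ∀ {n} c (v : Poly n) → p ∣ evalMonic (vanishingConstant c v ∷ v) (toℕ c)
  vanishingConstant-root c v = ≈0⇒∣ (begin
    evalMonic (vanishingConstant c v ∷ v) (toℕ c)  ≡⟨ evalMonic-∷ (vanishingConstant c v) v (toℕ c) ⟩
    toℕ (neg K mod p) + K                          ≈⟨ +-congʳ K (toℕ-mod (neg K)) ⟩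
    neg K + K                                      ≡⟨ +-comm (neg K) K ⟩
    K + neg K                                      ≈⟨ +-neg K ⟩
    0                                              ∎)
    where
    open ≈-Reasoning
    K : ℕ
    K = toℕ c * evalMonic v (toℕ c)

  root⇒vanishingConstant : ∀ {n} c a (v : Poly n) →
                           p ∣ evalMonic (a ∷ v) (toℕ c) → a ≡ vanishingConstant c v
  root⇒vanishingConstant c a v p∣f[c] = toℕ-≈-injective (begin
    toℕ a                              ≡⟨ +-identityʳ (toℕ a) ⟨
    toℕ a + 0                          ≈⟨ +-congˡ (toℕ a) (≈-sym (+-neg K)) ⟩
    toℕ a + (K + neg K)                ≡⟨ +-assoc (toℕ a) K (neg K) ⟨
    toℕ a + K + neg K                  ≡⟨ cong (_+ neg K) (evalMonic-∷ a v (toℕ c)) ⟨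
    evalMonic (a ∷ v) (toℕ c) + neg K  ≈⟨ +-congʳ (neg K) (∣⇒≈0 p∣f[c]) ⟩
    neg K                              ≈⟨ ≈-sym (toℕ-mod (neg K)) ⟩
    toℕ (neg K mod p)                  ∎)
    where
    open ≈-Reasoning
    K : ℕ
    K = toℕ c * evalMonic v (toℕ c)

  -- Exactly one constant term a₀ makes a ∷ v vanish at c, and a₀ ∷ v has the same
  -- roots in S as quotient c v.
  ∑-noRootIn-∷ : ∀ {n} {c S} → All (c ≢_) S → (v : Poly n) →
    ∑[ a < p ] noRootIn S (a ∷ v) ≡ ∑[ a < p ] noRootIn (c ∷ S) (a ∷ v) + noRootIn S (quotient c v)
  ∑-noRootIn-∷ {c = c} {S} c∉S v = begin
    ∑[ a < p ] noRootIn S (a ∷ v)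
      ≡⟨ ∑-pull-out (λ a → noRootIn S (a ∷ v)) (λ a → noRootIn (c ∷ S) (a ∷ v)) a₀ off-a₀ at-a₀ ⟩
    ∑[ a < p ] noRootIn (c ∷ S) (a ∷ v) + noRootIn S (a₀ ∷ v)
      ≡⟨ cong (∑[ a < p ] noRootIn (c ∷ S) (a ∷ v) +_)
              (noRootIn-quotient a₀ v (vanishingConstant-root c v) c∉S) ⟩
    ∑[ a < p ] noRootIn (c ∷ S) (a ∷ v) + noRootIn S (quotient c v) ∎
    where
    open ≡-Reasoning
    a₀ : Fin p
    a₀ = vanishingConstant c v
    off-a₀ : ∀ a → a ≢ a₀ → noRootIn S (a ∷ v) ≡ noRootIn (c ∷ S) (a ∷ v)
    off-a₀ a a≢a₀ = sym (trans
      (cong (_* noRootIn S (a ∷ v)) ([p∤]-∤ (λ p∣f[c] → a≢a₀ (root⇒vanishingConstant c a v p∣f[c]))))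
      (*-identityˡ _))
    at-a₀ : noRootIn (c ∷ S) (a₀ ∷ v) ≡ 0
    at-a₀ = cong (_* noRootIn S (a₀ ∷ v)) ([p∤]-∣ (vanishingConstant-root c v))

  -- quotient c is a bijection: it translates each coefficient by an amount that
  -- depends only on the higher coefficients.
  sumMonic-quotient : ∀ c n (G : Poly n → ℕ) → sumMonic n (λ v → G (quotient c v)) ≡ sumMonic n G
  sumMonic-quotient c zero    G = refl
  sumMonic-quotient c (suc n) G = trans
    (sumMonic-cong n (λ w → ∑-shift (toℕ c * evalMonic w (toℕ c)) (λ r → G (r ∷ quotient c w))))
    (sumMonic-quotient c n (λ u → ∑[ r < p ] G (r ∷ u)))

  rootFree : List (Fin p) → ℕ → ℕ
  rootFree S n = sumMonic n (noRootIn S)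

  rootFree-∷ : ∀ {c S} → All (c ≢_) S → ∀ n →
               rootFree (c ∷ S) (suc n) + rootFree S n ≡ rootFree S (suc n)
  rootFree-∷ {c} {S} c∉S n = begin
    sumMonic n (λ v → ∑[ a < p ] noRootIn (c ∷ S) (a ∷ v)) + sumMonic n (noRootIn S)
      ≡⟨ cong (rootFree (c ∷ S) (suc n) +_) (sumMonic-quotient c n (noRootIn S)) ⟨
    sumMonic n (λ v → ∑[ a < p ] noRootIn (c ∷ S) (a ∷ v)) + sumMonic n (λ v → noRootIn S (quotient c v))
      ≡⟨ sumMonic-distrib-+ n _ _ ⟨
    sumMonic n (λ v → ∑[ a < p ] noRootIn (c ∷ S) (a ∷ v) + noRootIn S (quotient c v))
      ≡⟨ sumMonic-cong n (λ v → sym (∑-noRootIn-∷ c∉S v)) ⟩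
    rootFree S (suc n) ∎
    where open ≡-Reasoning

  rootFree-[] : ∀ n → rootFree [] n ≡ p ^ n
  rootFree-[] n = trans (sumMonic-const n 1) (*-identityʳ (p ^ n))

  rootFree-zero : ∀ S → rootFree S 0 ≡ 1
  rootFree-zero S = noRootIn-rootless S [] (λ _ p∣1 → <⇒≢ 1<p (sym (∣1⇒≡1 p∣1)))
    where
    1<p : 1 < p
    1<p = nonTrivial⇒n>1 p {{prime⇒nonTrivial pp}}

  A≡rootFree : ∀ n → A p n ≡ rootFree (allFin p) n
  A≡rootFree n = trans (length-filter≡sum (λ f → ¬? (hasRoot? f)) (allMonic p n))
    (trans (sum-map-allMonic n _) (sumMonic-cong n indicator≡noRootIn))
    where
    indicator≡noRootIn : ∀ f → (if does (¬? (hasRoot? f)) then 1 else 0) ≡ noRootIn (allFin p) f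
    indicator≡noRootIn f with hasRoot? f
    ... | yes (c , p∣f[c]) = sym (noRootIn-∈ (allFin p) f (∈-allFin c) p∣f[c])
    ... | no rootless      = sym (noRootIn-rootless (allFin p) f (λ d p∣f[d] → rootless (d , p∣f[d])))

  length-allFin : length (allFin p) ≡ p
  length-allFin = length-tabulate (λ i → i)

  open Bonferroni p rootFree rootFree-[] rootFree-zero rootFree-∷ using (bonferroni₂; bonferroni₃)

  A-bonferroni₂ : ∀ n → p * A p (suc n) + p * p ^ suc n ≤ p ^ suc (suc n) + (p C 2) * p ^ n
  A-bonferroni₂ n = subst₂ (λ N k → p * N + k * p ^ suc n ≤ p ^ suc (suc n) + (k C 2) * p ^ n)
    (sym (A≡rootFree (suc n))) length-allFin (bonferroni₂ (allFin⁺ p) n)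

  A-bonferroni₃ : ∀ n →
    p ^ (3 + n) + (p C 2) * p ^ suc n ≤ p * A p (2 + n) + p * p ^ (2 + n) + (p C 3) * p ^ n
  A-bonferroni₃ n = subst₂
    (λ N k → p ^ (3 + n) + (k C 2) * p ^ suc n ≤ p * N + k * p ^ (2 + n) + (k C 3) * p ^ n)
    (sym (A≡rootFree (2 + n))) length-allFin (bonferroni₃ (allFin⁺ p) n)

open import Defs
open import Data.Nat.Properties using (m^n≢0; m*n≢0)
open import Data.Nat.Primality using (prime⇒nonZero; prime⇒nonTrivial)
open import Data.Integer using (+_)
open import Data.Rational using (_≤_; _<_; _/_)
open import Data.Product using (_×_; _,_)
open Fraction using (fraction-≤; fraction-<)
open Estimates using (quarter-bound; half-bound; upper-bound; lower-bound)

lemma7 : (p n : ℕ) (pp : Prime p) → n ≥ 2 →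
    ((+ 1) / 4 ≤ lowerBound p pp) × (lowerBound p pp ≤ C p n pp)
      × (C p n pp ≤ upperBound p pp) × (upperBound p pp < (+ 1) / 2)
lemma7 p (suc (suc m)) pp (s≤s (s≤s z≤n)) =
    fraction-≤ 1 4 (p ^ 2 ∸ 1) (3 * p ^ 2) (quarter-bound p (nonTrivial⇒n>1 p))
  , fraction-≤ (p ^ 2 ∸ 1) (3 * p ^ 2) (A p n) (p ^ n) (lower-bound p m (A p n) (A-bonferroni₃ m))
  , fraction-≤ (A p n) (p ^ n) (p ∸ 1) (2 * p) (upper-bound p (suc m) (A p n) (A-bonferroni₂ (suc m)))
  , fraction-< (p ∸ 1) (2 * p) 1 2 (half-bound p (nonTrivial⇒n>1 p))
  where
  open RootCounting p pp using (A-bonferroni₂; A-bonferroni₃)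
  n : ℕ
  n = suc (suc m)
  instance
    p-nonTrivial : NonTrivial p
    p-nonTrivial = prime⇒nonTrivial pp
    p≢0 : NonZero p
    p≢0 = prime⇒nonZero pp
    pⁿ≢0 : NonZero (p ^ n)
    pⁿ≢0 = m^n≢0 p n
    2p≢0 : NonZero (2 * p)
    2p≢0 = m*n≢0 2 p
    3p²≢0 : NonZero (3 * p ^ 2)
    3p²≢0 = m*n≢0 3 (p ^ 2) {{_}} {{m^n≢0 p 2}}
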